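{- Let $x\in(0,1]$ and run the algorithm described in the context. Suppose $c_1,b_1,\ldots,b_{k-1},c_k,b_k$ have been defined. Then for all $1\leq n\leq k$, $$t_{n-1}(t_n+t_{n-1})>q_n(q_n-q_{n-1}).$$
   Context: For $y\in(0,1]$, $a_n(y)$ is the $n$-th partial quotient of the regular continued fraction $y=[a_1,a_2,\ldots]=1/(a_1+1/(a_2+\cdots))$; rationals are written with last partial quotient at least $2$ (and $1=[1]$). Algorithm: given $x\in(0,1]$, set $c_1=a_1(x)+1$. For $n\geq1$, with $\frac{p_n}{q_n}=[c_1,\ldots,c_n]$, set $b_n=a_n\!\left(x-\frac{p_n}{q_n}\right)$; with $\frac{s_n}{t_n}=[b_1,\ldots,b_n]$, set $c_{n+1}=a_{n+1}\!\left(x-\frac{s_n}{t_n}\right)+1$; terminate at the first step where the required partial quotient does not exist. Here $q_n$, $t_n$ are the continuants (denominators) of $[c_1,\ldots,c_n]$, $[b_1,\ldots,b_n]$, with conventions $q_0=t_0=1$, $q_{ -1}=t_{ -1}=0$. -}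

module Defs where

open import Level using (0ℓ)
open import Data.Nat as ℕ using (ℕ; zero; suc; _∸_; _≤_)
open import Data.Integer as ℤ using (ℤ; +_)
open import Data.Rational as ℚ using (ℚ; 0ℚ; 1ℚ; _<_)
open import Data.List using (List; []; _∷_; _∷ʳ_; length; foldl)
open import Data.List.Relation.Unary.All using (All)
open import Data.Product using (Σ; ∃; _×_; _,_)
open import Data.Sum using (_⊎_)
open import Relation.Nullary using (¬_)
open import Relation.Binary.PropositionalEquality using (_≡_)

-- Real numbers as Dedekind cuts of ℚ  (L q  means  q < x,  U q  means  x < q)

record ℝ : Set₁ where
  field
    L U      : ℚ → Set
    L-inh    : ∃ λ q → L q
    U-inh    : ∃ λ q → U q
    L-down   : ∀ {p q} → p < q → L q → L p
    L-round  : ∀ {q} → L q → ∃ λ r → q < r × L r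
    U-up     : ∀ {p q} → p < q → U p → U q
    U-round  : ∀ {q} → U q → ∃ λ r → r < q × U r
    disjoint : ∀ q → ¬ (L q × U q)
    located  : ∀ {p q} → p < q → L p ⊎ U q
open ℝ public

InUnit : ℝ → Set
InUnit x = L x 0ℚ × ¬ L x 1ℚ

-- Finite continued fractions [a₁,…,aₙ] = 1/(a₁ + 1/(a₂ + ⋯))

-- convergent recursion with p₋₁ = 1, p₀ = 0, q₋₁ = 0, q₀ = 1:
-- state (p_{n-1}, q_{n-1}, p_n, q_n)
record St : Set where
  constructor st
  field pp qp p q : ℕ

step : St → ℕ → St
step (st pp qp p q) a = st p q (a ℕ.* p ℕ.+ pp) (a ℕ.* q ℕ.+ qp)

conv : List ℕ → St
conv = foldl step (st 1 0 0 1)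

numer : List ℕ → ℕ
numer as = St.p (conv as)

denom : List ℕ → ℕ
denom as = St.q (conv as)

-- p / q as a rational; the denominator-zero case never occurs for lists
-- of positive partial quotients (then q ≥ 1), it is junk.
frac : ℕ → ℕ → ℚ
frac p zero    = 0ℚ
frac p (suc q) = (+ p) ℚ./ suc q

cfval : List ℕ → ℚ
cfval as = frac (numer as) (denom as)

-- Partial quotients of y = x - v  (x real, v rational).
-- Comparisons  y < r  ⇔  x < r + v.

-- y has regular CF expansion (with the paper's convention) beginning
-- with  as ++ [a]  (all entries assumed ≥ 1): y lies strictly between
-- [as,a] and [as,a+1], or y = [as,a] and this is the admissible
-- representation (a ≥ 2, or the expansion is [1]).
InCyl : ℝ → ℚ → List ℕ → ℕ → Set
InCyl x v as a =
    ((L x (e₁ ℚ.+ v) × U x (e₂ ℚ.+ v)) ⊎ (L x (e₂ ℚ.+ v) × U x (e₁ ℚ.+ v)))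
  ⊎ ((¬ L x (e₁ ℚ.+ v) × ¬ U x (e₁ ℚ.+ v)) × (2 ≤ a ⊎ (as ≡ [] × a ≡ 1)))
  where
  e₁ = cfval (as ∷ʳ a)
  e₂ = cfval (as ∷ʳ suc a)

-- PQ x v n a :  the n-th partial quotient a_n(x - v) exists and equals a  (n ≥ 1)
PQ : ℝ → ℚ → ℕ → ℕ → Set
PQ x v n a = Σ (List ℕ) λ as →
  length as ≡ n ∸ 1 × All (1 ≤_) as × 1 ≤ a × InCyl x v as a

-- The algorithm.  Sequences are indexed from 1 (value at 0 unused).

pre : (ℕ → ℕ) → ℕ → List ℕ
pre f zero    = []
pre f (suc n) = pre f n ∷ʳ f (suc n)

Run : ℝ → ℕ → (c b : ℕ → ℕ) → Set
Run x k c b =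
    (∃ λ a → PQ x 0ℚ 1 a × c 1 ≡ suc a)
  × (∀ n → 1 ≤ n → n ≤ k → PQ x (cfval (pre c n)) n (b n))
  × (∀ n → 1 ≤ n → suc n ≤ k →
       ∃ λ a → PQ x (cfval (pre b n)) (suc n) a × c (suc n) ≡ suc a)

qₙ : (c : ℕ → ℕ) → ℕ → ℕ
qₙ c n = denom (pre c n)

-- Write p/q and s/t for the convergents of [c₁, c₂, …] and [b₁, b₂, …], and let n = m + 1. Along the
-- run, x − pₙ/qₙ lies in the cylinder of [b₁, …, bₙ] and x − sₘ/tₘ in that of [c₁, …, cₘ, cₙ − 1];
-- in particular [c₁, …, cₘ, cₙ − 1] + sₘ/tₘ ≤ x < [b₁, …, bₘ, bₙ + 1] + pₙ/qₙ in the order of the parity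
-- of m. By the determinant identity pₙqₘ − pₘqₙ = ±1, measured in that order the right side exceeds
-- the left by 1/(qₙ(qₙ − qₘ)) − 1/(tₘ(tₙ + tₘ)), so the comparison says exactly qₙ(qₙ − qₘ) < tₘ(tₙ + tₘ).
--
-- The algorithm only says that the partial
-- quotients of x − pₙ/qₙ start with some list of length m; it is [b₁, …, bₘ] because a prefix of the
-- expansion is determined by any cylinder known to contain the number (proved for a cut of the
-- fractions by pulling it back along r ↦ 1/r − a). The induction also carries cₙ ≤ bₙ, which follows
-- from the inequality above and the previous b-cylinder (or x ≤ 1), and hence qₙ ≤ tₙ; this is what
-- places x − sₙ/tₙ in the next c-cylinder.

module Submission where

open import Defs

module Proof where

  open import Data.Bool using (Bool; true; false; not)
  open import Data.Bool.Properties using (not-involutive)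
  open import Data.Empty using (⊥-elim)
  open import Data.Integer as ℤ using (+<+; +≤+)
  import Data.Integer.Properties as ℤP
  open import Data.List using (List; []; _∷_; _∷ʳ_; foldl; length)
  open import Data.List.Properties using (foldl-∷ʳ; length-++)
  open import Data.List.Relation.Unary.All using (All; []; _∷_)
  open import Data.List.Relation.Unary.All.Properties using (∷ʳ⁺)
  open import Data.Nat using (ℕ; zero; suc; _+_; _*_; _∸_; _<_; _≤_; z≤n; s≤s)
  open import Data.Nat.Properties as ℕP
    using (+-suc; +-cancelʳ-≡; +-cancelˡ-<; +-cancelʳ-<; +-cancelʳ-≤; +-monoˡ-<; +-monoʳ-≤; +-monoʳ-<;
           _<?_; ≮⇒≥; n≮n; ≤-pred; ≤-antisym; suc-injective; *-identityˡ; +-identityʳ; m≤m+n; <-asym; n<1+n)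
  open import Data.Nat.Tactic.RingSolver using (solve-∀)
  open import Data.Product as Prod using (Σ; _×_; _,_; proj₁; proj₂; swap)
  open import Data.Rational as ℚ using (ℚ; toℚᵘ)
  import Data.Rational.Properties as ℚP
  open import Data.Rational.Unnormalised as ℚᵘ using (mkℚᵘ; *<*; *≤*; *≡*)
  import Data.Rational.Unnormalised.Properties as ℚᵘP
  open import Data.Sum as Sum using (_⊎_; inj₁; inj₂; [_,_]′)
  open import Function using (_∘_)
  open import Level using (0ℓ)
  open import Relation.Binary.Core using (Rel)
  open import Relation.Binary.Definitions using (Decidable)
  open import Relation.Binary.PropositionalEquality
    using (_≡_; refl; sym; trans; cong; cong₂; subst; subst₂; module ≡-Reasoning)
  open import Relation.Nullary using (¬_)
  open import Relation.Nullary.Decidable using (decidable-stable)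

  Oriented : {A : Set} → Bool → Rel A 0ℓ → Rel A 0ℓ
  Oriented true  R a b = R a b
  Oriented false R a b = R b a

  oriented-+ˡ : ∀ σ v {r r′} → Oriented σ ℚ._<_ r r′ → Oriented σ ℚ._<_ (r ℚ.+ v) (r′ ℚ.+ v)
  oriented-+ˡ true  v = ℚP.+-monoˡ-< v
  oriented-+ˡ false v = ℚP.+-monoˡ-< v

  oriented-+ʳ-≤ : ∀ σ v {r r′} → Oriented σ ℚ._<_ r r′ → Oriented σ ℚ._≤_ (v ℚ.+ r) (v ℚ.+ r′)
  oriented-+ʳ-≤ true  v = ℚP.<⇒≤ ∘ ℚP.+-monoʳ-< v
  oriented-+ʳ-≤ false v = ℚP.<⇒≤ ∘ ℚP.+-monoʳ-< v

  oriented-not : ∀ σ {A : Set} {R : Rel A 0ℓ} {a b} → Oriented (not σ) R a b → Oriented σ R b a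
  oriented-not true  h = h
  oriented-not false h = h

  -- Continuants and their determinants

  conv-∷ʳ : ∀ as a → conv (as ∷ʳ a) ≡ step (conv as) a
  conv-∷ʳ as a = foldl-∷ʳ step (st 1 0 0 1) a as

  -- Reading st pp qp p q as the matrix [p pp; q qp], step multiplies on the right by [a 1; 1 0]
  -- and conv starts from [0 1; 1 0], which is its own inverse; _⊛_ is the product S · [0 1; 1 0] · T.
  _⊛_ : St → St → St
  st pp qp p q ⊛ st PP QP P Q =
    st (p * QP + pp * PP) (q * QP + qp * PP) (p * Q + pp * P) (q * Q + qp * P)

  st-cong : ∀ {pp qp p q pp′ qp′ p′ q′} → pp ≡ pp′ → qp ≡ qp′ → p ≡ p′ → q ≡ q′ →
            st pp qp p q ≡ st pp′ qp′ p′ q′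
  st-cong refl refl refl refl = refl

  foldl-step : ∀ S as → foldl step S as ≡ S ⊛ conv as
  foldl-step (st pp qp p q) [] = st-cong (unit pp p) (unit qp q) (unit′ p pp) (unit′ q qp)
    where
    unit : ∀ x y → x ≡ y * 0 + x * 1
    unit = solve-∀
    unit′ : ∀ x y → x ≡ x * 1 + y * 0
    unit′ = solve-∀
  foldl-step S@(st pp qp p q) (a ∷ as) = begin
    foldl step (step S a) as                     ≡⟨ foldl-step (step S a) as ⟩
    step S a ⊛ conv as                           ≡⟨ step-⊛ (conv as) ⟩
    S ⊛ (step (st 1 0 0 1) a ⊛ conv as)          ≡⟨ cong (S ⊛_) (foldl-step (step (st 1 0 0 1) a) as) ⟨
    S ⊛ conv (a ∷ as)                            ∎
    where
    open ≡-Reasoning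
    assoc : ∀ a x y X Y →
      (a * x + y) * X + x * Y ≡ x * ((a * 1 + 0) * X + 1 * Y) + y * ((a * 0 + 1) * X + 0 * Y)
    assoc = solve-∀
    step-⊛ : ∀ T → step S a ⊛ T ≡ S ⊛ (step (st 1 0 0 1) a ⊛ T)
    step-⊛ (st PP QP P Q) =
      st-cong (assoc a p pp QP PP) (assoc a q qp QP PP) (assoc a p pp Q P) (assoc a q qp Q P)

  numer-∷ : ∀ a as → numer (a ∷ as) ≡ denom as
  numer-∷ a as = trans (cong St.p (foldl-step (step (st 1 0 0 1) a) as)) (simplify a (denom as) (numer as))
    where
    simplify : ∀ a X Y → (a * 0 + 1) * X + 0 * Y ≡ X
    simplify = solve-∀

  denom-∷ : ∀ a as → denom (a ∷ as) ≡ a * denom as + numer as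
  denom-∷ a as = trans (cong St.q (foldl-step (step (st 1 0 0 1) a) as)) (simplify a (denom as) (numer as))
    where
    simplify : ∀ a X Y → (a * 1 + 0) * X + 1 * Y ≡ a * X + Y
    simplify = solve-∀

  step-q-≥ : ∀ S {a} → 1 ≤ a → St.q S ≤ St.q (step S a)
  step-q-≥ S {suc a} _ = ℕP.≤-trans (m≤m+n (St.q S) (a * St.q S)) (m≤m+n _ (St.qp S))

  length-pre : ∀ f m → length (pre f m) ≡ m
  length-pre f zero    = refl
  length-pre f (suc m) = trans (length-++ (pre f m)) (trans (cong (_+ 1) (length-pre f m)) (ℕP.+-comm m 1))

  All-pre : ∀ f m → (∀ {i} → 1 ≤ i → i ≤ m → 1 ≤ f i) → All (1 ≤_) (pre f m)
  All-pre f zero    pos = []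
  All-pre f (suc m) pos = ∷ʳ⁺ (All-pre f m (λ 1≤i i≤m → pos 1≤i (ℕP.m≤n⇒m≤1+n i≤m))) (pos (s≤s z≤n) ℕP.≤-refl)

  -- For S = conv as, the values [as, 1], [as, 2], … then increase towards [as] in the order selected by σ.
  Det : Bool → St → Set
  Det true  (st pp qp p q) = p * qp ≡ suc (pp * q)
  Det false (st pp qp p q) = pp * q ≡ suc (p * qp)

  private
    det-expandʳ : ∀ a p q qp → p * (a * q + qp) ≡ a * p * q + p * qp
    det-expandʳ = solve-∀

    det-expandˡ : ∀ a p pp q → (a * p + pp) * q ≡ a * p * q + pp * q
    det-expandˡ = solve-∀

  det-step : ∀ σ S a → Det σ S → Det (not σ) (step S a)
  det-step true (st pp qp p q) a h = begin
    p * (a * q + qp)          ≡⟨ det-expandʳ a p q qp ⟩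
    a * p * q + p * qp        ≡⟨ cong (a * p * q +_) h ⟩
    a * p * q + suc (pp * q)  ≡⟨ +-suc _ _ ⟩
    suc (a * p * q + pp * q)  ≡⟨ cong suc (det-expandˡ a p pp q) ⟨
    suc ((a * p + pp) * q)    ∎
    where open ≡-Reasoning
  det-step false (st pp qp p q) a h = begin
    (a * p + pp) * q          ≡⟨ det-expandˡ a p pp q ⟩
    a * p * q + pp * q        ≡⟨ cong (a * p * q +_) h ⟩
    a * p * q + suc (p * qp)  ≡⟨ +-suc _ _ ⟩
    suc (a * p * q + p * qp)  ≡⟨ cong suc (det-expandʳ a p q qp) ⟨
    suc (p * (a * q + qp))    ∎
    where open ≡-Reasoning

  parity : ℕ → Bool
  parity zero    = false
  parity (suc m) = not (parity m)

  det-pre : ∀ f m → Det (parity m) (conv (pre f m))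
  det-pre f zero    = refl
  det-pre f (suc m) = subst (Det (parity (suc m))) (sym (conv-∷ʳ (pre f m) (f (suc m))))
    (det-step (parity m) (conv (pre f m)) (f (suc m)) (det-pre f m))

  Balance : Bool → ℕ → ℕ → ℕ → ℕ → Set
  Balance true  L R A B = R + A ≡ L + B
  Balance false L R A B = R + B ≡ L + A

  cancel-units : ∀ X Y A B u v → X + A * suc u + B * v ≡ Y + A * u + B * suc v → X + A ≡ Y + B
  cancel-units X Y A B u v h = +-cancelʳ-≡ (A * u + B * v) (X + A) (Y + B) (begin
    X + A + (A * u + B * v)  ≡⟨ regroupˡ X A B u v ⟩
    X + A * suc u + B * v    ≡⟨ h ⟩
    Y + A * u + B * suc v    ≡⟨ regroupʳ Y A B u v ⟩
    Y + B + (A * u + B * v)  ∎)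
    where
    open ≡-Reasoning
    regroupˡ : ∀ X A B u v → X + A + (A * u + B * v) ≡ X + A * suc u + B * v
    regroupˡ = solve-∀
    regroupʳ : ∀ Y A B u v → Y + A * u + B * suc v ≡ Y + B + (A * u + B * v)
    regroupʳ = solve-∀

  -- Cross-multiplying a comparison of convergents gives an identity in which the two determinants
  -- appear as unknowns; substituting their values leaves a Balance.
  det-balance : ∀ σ {pp qp p q pp′ qp′ p′ q′} → Det σ (st pp qp p q) → Det σ (st pp′ qp′ p′ q′) →
    ∀ L R A B → R + A * (p * qp) + B * (pp′ * q′) ≡ L + A * (pp * q) + B * (p′ * qp′) → Balance σ L R A B
  det-balance true {pp} {qp} {p} {q} {pp′} {qp′} {p′} {q′} d d′ L R A B h =
    cancel-units R L A B (pp * q) (pp′ * q′)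
      (subst₂ (λ u v → R + A * u + B * (pp′ * q′) ≡ L + A * (pp * q) + B * v) d d′ h)
  det-balance false {pp} {qp} {p} {q} {pp′} {qp′} {p′} {q′} d d′ L R A B h =
    sym (cancel-units L R A B (p * qp) (p′ * qp′)
      (sym (subst₂ (λ u v → R + A * (p * qp) + B * u ≡ L + A * v + B * (p′ * qp′)) d′ d h)))

  balance-< : ∀ σ {L R A B} → Balance σ L R A B → Oriented σ _<_ L R → A < B
  balance-< true  {L} {R} {A} {B} e h = +-cancelˡ-< L A B (subst (L + A <_) e (+-monoˡ-< A h))
  balance-< false {L} {R} {A} {B} e h = +-cancelˡ-< R A B (subst (R + A <_) (sym e) (+-monoˡ-< A h))

  balance-<⁻ : ∀ σ {L R A B} → Balance σ L R A B → A < B → Oriented σ _<_ L R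
  balance-<⁻ true  {L} {R} {A} {B} e h = +-cancelʳ-< A L R (subst (L + A <_) (sym e) (+-monoʳ-< L h))
  balance-<⁻ false {L} {R} {A} {B} e h = +-cancelʳ-< B R L (subst (_< L + B) (sym e) (+-monoʳ-< L h))

  balance-≤⁻ : ∀ σ {L R A B} → Balance σ L R A B → A ≤ B → Oriented σ _≤_ L R
  balance-≤⁻ true  {L} {R} {A} {B} e h = +-cancelʳ-≤ A L R (subst (L + A ≤_) (sym e) (+-monoʳ-≤ L h))
  balance-≤⁻ false {L} {R} {A} {B} e h = +-cancelʳ-≤ B R L (subst (_≤ L + B) (sym e) (+-monoʳ-≤ L h))

  -- Cylinders in a cut of the fractions

  -- (n , d) stands for n / (1 + d), so that no denominator vanishes.
  Fraction : Set
  Fraction = ℕ × ℕ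

  _<ᶠ_ : Rel Fraction 0ℓ
  (a , b) <ᶠ (c , d) = a * suc d < c * suc b

  _≤ᶠ_ : Rel Fraction 0ℓ
  (a , b) ≤ᶠ (c , d) = a * suc d ≤ c * suc b

  _<ᶠ?_ : Decidable _<ᶠ_
  (a , b) <ᶠ? (c , d) = a * suc d <? c * suc b

  ≮ᶠ⇒≥ᶠ : ∀ {p q} → ¬ p <ᶠ q → q ≤ᶠ p
  ≮ᶠ⇒≥ᶠ {a , b} {c , d} = ≮⇒≥

  <ᶠ-irrefl : ∀ p → ¬ p <ᶠ p
  <ᶠ-irrefl (a , b) = n≮n (a * suc b)

  unit-fraction-<ᶠ : ∀ {a c} → (1 , a) <ᶠ (1 , c) → c < a
  unit-fraction-<ᶠ {a} {c} h = ≤-pred (subst₂ _<_ (*-identityˡ (suc c)) (*-identityˡ (suc a)) h)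

  -- r ↦ 1 / (1 + a + r), the inverse branch of the Gauss map for the partial quotient 1 + a.
  prepend : ℕ → Fraction → Fraction
  prepend a (n , d) = (suc d , d + a * suc d + n)

  prepend-zero : ∀ a → prepend a (0 , 0) ≡ (1 , a)
  prepend-zero a = cong (1 ,_) (simplify a)
    where
    simplify : ∀ a → 0 + a * 1 + 0 ≡ a
    simplify = solve-∀

  private
    prepend-cross : ∀ a d m e → suc d * suc (e + a * suc e + m) ≡ suc d * suc e * suc a + m * suc d
    prepend-cross = solve-∀

    prepend-cross′ : ∀ a n d e → suc e * suc (d + a * suc d + n) ≡ suc d * suc e * suc a + n * suc e
    prepend-cross′ = solve-∀

  prepend-<ᶠ : ∀ a {p q} → q <ᶠ p → prepend a p <ᶠ prepend a q
  prepend-<ᶠ a {n , d} {m , e} h = subst₂ _<_ (sym (prepend-cross a d m e)) (sym (prepend-cross′ a n d e))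
    (+-monoʳ-< (suc d * suc e * suc a) h)

  prepend-<ᶠ⁻¹ : ∀ a {p q} → prepend a p <ᶠ prepend a q → q <ᶠ p
  prepend-<ᶠ⁻¹ a {n , d} {m , e} h = +-cancelˡ-< (suc d * suc e * suc a) _ _
    (subst₂ _<_ (prepend-cross a d m e) (prepend-cross′ a n d e) h)

  prepend-≤ᶠ : ∀ a {p q} → q ≤ᶠ p → prepend a p ≤ᶠ prepend a q
  prepend-≤ᶠ a {n , d} {m , e} h = subst₂ _≤_ (sym (prepend-cross a d m e)) (sym (prepend-cross′ a n d e))
    (+-monoʳ-≤ (suc d * suc e * suc a) h)

  -- [a₁, …, aₙ] computed from the front, for positive entries.
  fractionOf : List ℕ → Fraction
  fractionOf []       = (0 , 0)
  fractionOf (a ∷ as) = prepend (a ∸ 1) (fractionOf as)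

  incLast : List ℕ → List ℕ
  incLast []           = []
  incLast (a ∷ [])     = suc a ∷ []
  incLast (a ∷ b ∷ as) = a ∷ incLast (b ∷ as)

  incLast-∷ʳ : ∀ as a → incLast (as ∷ʳ a) ≡ as ∷ʳ suc a
  incLast-∷ʳ []           a = refl
  incLast-∷ʳ (b ∷ [])     a = refl
  incLast-∷ʳ (b ∷ c ∷ as) a = cong (b ∷_) (incLast-∷ʳ (c ∷ as) a)

  All-incLast : ∀ {as} → All (1 ≤_) as → All (1 ≤_) (incLast as)
  All-incLast {[]}         []       = []
  All-incLast {a ∷ []}     (_ ∷ []) = s≤s z≤n ∷ []
  All-incLast {a ∷ b ∷ as} (p ∷ ps) = p ∷ All-incLast ps

  -- The cut that a number y makes in the fractions: Lo r means r < y and Up r means y < r.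
  record Cut : Set₁ where
    field
      Lo Up   : Fraction → Set
      Lo-down : ∀ {p q} → q ≤ᶠ p → Lo p → Lo q
      Up-up   : ∀ {p q} → p ≤ᶠ q → Up p → Up q
      Lo<Up   : ∀ {p q} → Lo p → Up q → p <ᶠ q
      Lo⊎Up   : ∀ {p q} → p <ᶠ q → Lo p ⊎ Up q

    ¬Up<Up : ∀ {p q} → ¬ Up p → Up q → p <ᶠ q
    ¬Up<Up {p} {q} ¬up up = decidable-stable (p <ᶠ? q) (λ p≮q → ¬up (Up-up (≮ᶠ⇒≥ᶠ {p} {q} p≮q) up))

    Lo<¬Lo : ∀ {p q} → Lo p → ¬ Lo q → p <ᶠ q
    Lo<¬Lo {p} {q} lo ¬lo = decidable-stable (p <ᶠ? q) (λ p≮q → ¬lo (Lo-down (≮ᶠ⇒≥ᶠ {p} {q} p≮q) lo))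

    Lo⇒¬Up : ∀ {p} → Lo p → ¬ Up p
    Lo⇒¬Up {p} lo up = <ᶠ-irrefl p (Lo<Up lo up)

    ¬Up-down : ∀ {p q} → q ≤ᶠ p → ¬ Up p → ¬ Up q
    ¬Up-down q≤p ¬up = ¬up ∘ Up-up q≤p

    ¬Lo-up : ∀ {p q} → p ≤ᶠ q → ¬ Lo p → ¬ Lo q
    ¬Lo-up p≤q ¬lo = ¬lo ∘ Lo-down p≤q

    ¬Up⇒Lo : ∀ {p q} → q <ᶠ p → ¬ Up p → Lo q
    ¬Up⇒Lo q<p ¬up = [ (λ lo → lo) , (λ up → ⊥-elim (¬up up)) ]′ (Lo⊎Up q<p)

    ¬Lo⇒Up : ∀ {p q} → p <ᶠ q → ¬ Lo p → Up q
    ¬Lo⇒Up p<q ¬lo = [ (λ lo → ⊥-elim (¬lo lo)) , (λ up → up) ]′ (Lo⊎Up p<q)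

  -- The cut made by 1/y − (1 + a), read through prepend a; the two sides are exchanged.
  pull : ℕ → Cut → Cut
  pull a κ = record
    { Lo      = Up ∘ prepend a
    ; Up      = Lo ∘ prepend a
    ; Lo-down = λ {p} {q} q≤p → Up-up (prepend-≤ᶠ a {p} {q} q≤p)
    ; Up-up   = λ {p} {q} p≤q → Lo-down (prepend-≤ᶠ a {q} {p} p≤q)
    ; Lo<Up   = λ {p} {q} up lo → prepend-<ᶠ⁻¹ a {q} {p} (Lo<Up lo up)
    ; Lo⊎Up   = λ {p} {q} p<q → Sum.swap (Lo⊎Up (prepend-<ᶠ a {q} {p} p<q))
    }
    where open Cut κ

  open Cut

  Between : Cut → Fraction → Fraction → Set
  Between κ p q = (Lo κ p × Up κ q) ⊎ (Lo κ q × Up κ p)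

  HalfOpen : Cut → Fraction → Fraction → Set
  HalfOpen κ p q = (¬ Up κ p × Up κ q) ⊎ (Lo κ q × ¬ Lo κ p)

  -- Pulling back along prepend exchanges the two disjuncts of Between and of HalfOpen.
  mirror : {A B C D : Set} → (A × B) ⊎ (C × D) → (D × C) ⊎ (B × A)
  mirror = [ inj₂ ∘ swap , inj₁ ∘ swap ]′

  -- The cylinder of as is the interval between [as] and [incLast as].
  OpenCyl : Cut → List ℕ → Set
  OpenCyl κ as = Between κ (fractionOf as) (fractionOf (incLast as))

  HalfOpenCyl : Cut → List ℕ → Set
  HalfOpenCyl κ as = HalfOpen κ (fractionOf as) (fractionOf (incLast as))

  unit-fractions-decrease : ∀ a → ¬ (1 , a) <ᶠ (1 , suc a)
  unit-fractions-decrease a h = <-asym (n<1+n a) (unit-fraction-<ᶠ h)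

  private
    lower-bound : ∀ a b → (1 , suc a) ≤ᶠ prepend a (1 , b)
    lower-bound a b = subst₂ _≤_ (sym (expandˡ a b)) (sym (expandʳ a b)) (m≤m+n (suc a * suc b + 1) b)
      where
      expandˡ : ∀ a b → 1 * suc (b + a * suc b + 1) ≡ suc a * suc b + 1
      expandˡ = solve-∀
      expandʳ : ∀ a b → suc b * suc (suc a) ≡ suc a * suc b + 1 + b
      expandʳ = solve-∀

    upper-bound : ∀ a b → prepend a (1 , suc b) ≤ᶠ (1 , a)
    upper-bound a b = subst (suc (suc b) * suc a ≤_) (sym (expand a b)) (m≤m+n (suc (suc b) * suc a) 1)
      where
      expand : ∀ a b → 1 * suc (suc b + a * suc (suc b) + 1) ≡ suc (suc b) * suc a + 1
      expand = solve-∀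

  open-first-quotient : ∀ κ a as → All (1 ≤_) as → OpenCyl κ (suc a ∷ as) → Lo κ (1 , suc a) × Up κ (1 , a)
  open-first-quotient κ a [] [] o with subst₂ (Between κ) (prepend-zero a) (prepend-zero (suc a)) o
  ... | inj₁ (lo , up) = ⊥-elim (unit-fractions-decrease a (Lo<Up κ lo up))
  ... | inj₂ lo-up     = lo-up
  open-first-quotient κ a (suc b ∷ bs) (_ ∷ pbs) o with open-first-quotient (pull a κ) b bs pbs (mirror o)
  ... | up , lo = Lo-down κ (lower-bound a b) lo , Up-up κ (upper-bound a b) up

  halfOpen-first-quotient : ∀ κ a as → All (1 ≤_) as → HalfOpenCyl κ (suc a ∷ as) →
                            ¬ Up κ (1 , suc a) × ¬ Lo κ (1 , a)
  halfOpen-first-quotient κ a [] [] h with subst₂ (HalfOpen κ) (prepend-zero a) (prepend-zero (suc a)) h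
  ... | inj₁ (¬up , up) = ⊥-elim (unit-fractions-decrease a (¬Up<Up κ ¬up up))
  ... | inj₂ (lo , ¬lo) = Lo⇒¬Up κ lo , ¬lo
  halfOpen-first-quotient κ a (suc b ∷ bs) (_ ∷ pbs) h
    with halfOpen-first-quotient (pull a κ) b bs pbs (mirror h)
  ... | ¬lo , ¬up = ¬Up-down κ (lower-bound a b) ¬up , ¬Lo-up κ (upper-bound a b) ¬lo

  first-quotient-unique : ∀ κ {a c} → Lo κ (1 , suc a) × Up κ (1 , a) → ¬ Up κ (1 , suc c) × ¬ Lo κ (1 , c) →
                          a ≡ c
  first-quotient-unique κ (lo , up) (¬up , ¬lo) =
    ≤-antisym (≤-pred (unit-fraction-<ᶠ (¬Up<Up κ ¬up up))) (≤-pred (unit-fraction-<ᶠ (Lo<¬Lo κ lo ¬lo)))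

  cylinder-unique : ∀ κ as cs → length as ≡ length cs → All (1 ≤_) as → All (1 ≤_) cs →
                    OpenCyl κ as → HalfOpenCyl κ cs → as ≡ cs
  cylinder-unique κ []           []           _   _          _          _ _ = refl
  cylinder-unique κ (suc a ∷ as) (suc c ∷ cs) len (_ ∷ pas) (_ ∷ pcs) o h
    with refl ← first-quotient-unique κ (open-first-quotient κ a as pas o)
                                        (halfOpen-first-quotient κ c cs pcs h)
    = cong (suc a ∷_) (tails as cs (suc-injective len) pas pcs o h)
    where
    tails : ∀ as cs → length as ≡ length cs → All (1 ≤_) as → All (1 ≤_) cs →
            OpenCyl κ (suc a ∷ as) → HalfOpenCyl κ (suc a ∷ cs) → as ≡ cs
    tails []       []       _   _   _   _ _ = refl
    tails (b ∷ bs) (d ∷ ds) len pas pcs o h =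
      cylinder-unique (pull a κ) (b ∷ bs) (d ∷ ds) len pas pcs (mirror o) (mirror h)

  -- InCyl read in a cut; the exceptional expansion [1] is left out, as only nonempty prefixes occur.
  InCylᶜ : Cut → List ℕ → ℕ → Set
  InCylᶜ κ as a = Between κ e₁ e₂ ⊎ ((¬ Lo κ e₁ × ¬ Up κ e₁) × 2 ≤ a)
    where
    e₁ = fractionOf (as ∷ʳ a)
    e₂ = fractionOf (as ∷ʳ suc a)

  InCylᶜ-pull : ∀ κ a₀ as a → InCylᶜ κ (suc a₀ ∷ as) a → InCylᶜ (pull a₀ κ) as a
  InCylᶜ-pull κ a₀ as a = Sum.map mirror (Prod.map₁ swap)

  InCylᶜ-unit-interval : ∀ κ a → 1 ≤ a → InCylᶜ κ [] a → Lo κ (0 , 0) × Up κ (1 , 0)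
  InCylᶜ-unit-interval κ (suc a) _ (inj₁ between)
    with subst₂ (Between κ) (prepend-zero a) (prepend-zero (suc a)) between
  ... | inj₁ (lo , up) = ⊥-elim (unit-fractions-decrease a (Lo<Up κ lo up))
  ... | inj₂ (lo , up) = Lo-down κ z≤n lo , Up-up κ (s≤s z≤n) up
  InCylᶜ-unit-interval κ (suc a) _ (inj₂ ((¬lo , ¬up) , s≤s 1≤a))
    rewrite prepend-zero a =
    ¬Up⇒Lo κ (s≤s z≤n) ¬up , ¬Lo⇒Up κ (s≤s (subst (1 ≤_) (sym (+-identityʳ a)) 1≤a)) ¬lo

  InCylᶜ⇒OpenCyl : ∀ κ a₀ as a → All (1 ≤_) as → 1 ≤ a → InCylᶜ κ (suc a₀ ∷ as) a → OpenCyl κ (suc a₀ ∷ as)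
  InCylᶜ⇒OpenCyl κ a₀ [] a [] 1≤a h with InCylᶜ-unit-interval (pull a₀ κ) a 1≤a (InCylᶜ-pull κ a₀ [] a h)
  ... | up , lo = inj₂ (subst (Lo κ) (sym (prepend-suc-zero a₀)) lo , up)
    where
    prepend-suc-zero : ∀ a → prepend (suc a) (0 , 0) ≡ prepend a (1 , 0)
    prepend-suc-zero a = cong (1 ,_) (simplify a)
      where
      simplify : ∀ a → 0 + suc a * 1 + 0 ≡ 0 + a * 1 + 1
      simplify = solve-∀
  InCylᶜ⇒OpenCyl κ a₀ (suc b ∷ bs) a (_ ∷ pbs) 1≤a h =
    mirror (InCylᶜ⇒OpenCyl (pull a₀ κ) b bs a pbs 1≤a (InCylᶜ-pull κ a₀ (suc b ∷ bs) a h))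

  -- Comparing convergents in ℚ

  toℚᵘ-frac : ∀ a b → toℚᵘ (frac a (suc b)) ℚᵘ.≃ mkℚᵘ (ℤ.+ a) b
  toℚᵘ-frac a b = ℚP.toℚᵘ-fromℚᵘ (mkℚᵘ (ℤ.+ a) b)

  frac-< : ∀ {a b c d} → 1 ≤ b → 1 ≤ d → a * d < c * b → frac a b ℚ.< frac c d
  frac-< {a} {suc b} {c} {suc d} _ _ h = ℚP.toℚᵘ-cancel-<
    (ℚᵘP.<-respˡ-≃ (ℚᵘP.≃-sym (toℚᵘ-frac a b))
    (ℚᵘP.<-respʳ-≃ (ℚᵘP.≃-sym (toℚᵘ-frac c d))
    (*<* (subst₂ ℤ._<_ (ℤP.pos-* a (suc d)) (ℤP.pos-* c (suc b)) (+<+ h)))))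

  frac-<⁻¹ : ∀ {a b c d} → 1 ≤ b → 1 ≤ d → frac a b ℚ.< frac c d → a * d < c * b
  frac-<⁻¹ {a} {suc b} {c} {suc d} _ _ h
    with ℚᵘP.<-respˡ-≃ (toℚᵘ-frac a b)
           (ℚᵘP.<-respʳ-≃ (toℚᵘ-frac c d) (ℚP.toℚᵘ-mono-< h))
  ... | *<* h′ = ℤP.drop‿+<+ (subst₂ ℤ._<_ (sym (ℤP.pos-* a (suc d))) (sym (ℤP.pos-* c (suc b))) h′)

  frac-≤ : ∀ {a b c d} → 1 ≤ b → 1 ≤ d → a * d ≤ c * b → frac a b ℚ.≤ frac c d
  frac-≤ {a} {suc b} {c} {suc d} _ _ h = ℚP.toℚᵘ-cancel-≤
    (ℚᵘP.≤-respˡ-≃ (ℚᵘP.≃-sym (toℚᵘ-frac a b))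
    (ℚᵘP.≤-respʳ-≃ (ℚᵘP.≃-sym (toℚᵘ-frac c d))
    (*≤* (subst₂ ℤ._≤_ (ℤP.pos-* a (suc d)) (ℤP.pos-* c (suc b)) (+≤+ h)))))

  frac-+ : ∀ {a b c d} → 1 ≤ b → 1 ≤ d → frac a b ℚ.+ frac c d ≡ frac (a * d + c * b) (b * d)
  frac-+ {a} {suc b} {c} {suc d} _ _ = ℚP.toℚᵘ-injective
    (ℚᵘP.≃-trans (ℚP.toℚᵘ-homo-+ (frac a (suc b)) (frac c (suc d)))
    (ℚᵘP.≃-trans (ℚᵘP.+-cong (toℚᵘ-frac a b) (toℚᵘ-frac c d))
    (ℚᵘP.≃-trans (*≡* (cong (ℤ._* ℤ.+ suc (d + b * suc d)) numerator))
    (ℚᵘP.≃-sym (toℚᵘ-frac (a * suc d + c * suc b) (d + b * suc d))))))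
    where
    numerator : ℤ.+ a ℤ.* ℤ.+ suc d ℤ.+ ℤ.+ c ℤ.* ℤ.+ suc b ≡ ℤ.+ (a * suc d + c * suc b)
    numerator = trans (cong₂ ℤ._+_ (sym (ℤP.pos-* a (suc d))) (sym (ℤP.pos-* c (suc b))))
                      (sym (ℤP.pos-+ (a * suc d) (c * suc b)))

  toℚ : Fraction → ℚ
  toℚ (n , d) = frac n (suc d)

  toℚ-< : ∀ {p q} → p <ᶠ q → toℚ p ℚ.< toℚ q
  toℚ-< {a , b} {c , d} = frac-< {a} {suc b} {c} {suc d} (s≤s z≤n) (s≤s z≤n)

  toℚ-<⁻¹ : ∀ {p q} → toℚ p ℚ.< toℚ q → p <ᶠ q
  toℚ-<⁻¹ {a , b} {c , d} = frac-<⁻¹ {a} {suc b} {c} {suc d} (s≤s z≤n) (s≤s z≤n)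

  toℚ-≤ : ∀ {p q} → p ≤ᶠ q → toℚ p ℚ.≤ toℚ q
  toℚ-≤ {a , b} {c , d} = frac-≤ {a} {suc b} {c} {suc d} (s≤s z≤n) (s≤s z≤n)

  numer-denom-fractionOf : ∀ as → All (1 ≤_) as →
    numer as ≡ proj₁ (fractionOf as) × denom as ≡ suc (proj₂ (fractionOf as))
  numer-denom-fractionOf []           []        = refl , refl
  numer-denom-fractionOf (suc a ∷ as) (_ ∷ pas) with numer-denom-fractionOf as pas
  ... | n≡ , d≡ = trans (numer-∷ (suc a) as) d≡ ,
                  trans (denom-∷ (suc a) as) (cong₂ (λ u w → suc a * u + w) d≡ n≡)

  cfval-fractionOf : ∀ as → All (1 ≤_) as → cfval as ≡ toℚ (fractionOf as)
  cfval-fractionOf as pas =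
    cong₂ frac (proj₁ (numer-denom-fractionOf as pas)) (proj₂ (numer-denom-fractionOf as pas))

  denom-positive : ∀ as → All (1 ≤_) as → 1 ≤ denom as
  denom-positive as pas = subst (1 ≤_) (sym (proj₂ (numer-denom-fractionOf as pas))) (s≤s z≤n)

  value : St → ℚ
  value S = frac (St.p S) (St.q S)

  cfval-∷ʳ : ∀ as a → cfval (as ∷ʳ a) ≡ value (step (conv as) a)
  cfval-∷ʳ as a = cong value (conv-∷ʳ as a)

  cfval-incLast-∷ʳ : ∀ as a → cfval (incLast (as ∷ʳ a)) ≡ value (step (conv as) (suc a))
  cfval-incLast-∷ʳ as a = trans (cong cfval (incLast-∷ʳ as a)) (cfval-∷ʳ as (suc a))

  value-step-one : ∀ S a → value (step (step S a) 1) ≡ value (step S (suc a))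
  value-step-one (st pp qp p q) a = cong₂ frac (regroup a p pp) (regroup a q qp)
    where
    regroup : ∀ a p pp → 1 * (a * p + pp) + p ≡ suc a * p + pp
    regroup = solve-∀

  *-positive : ∀ {m n} → 1 ≤ m → 1 ≤ n → 1 ≤ m * n
  *-positive = ℕP.*-mono-≤

  step-positive : ∀ {a q} qp → 1 ≤ a → 1 ≤ q → 1 ≤ a * q + qp
  step-positive {a} {q} qp 1≤a 1≤q = ℕP.≤-trans (*-positive 1≤a 1≤q) (m≤m+n (a * q) qp)

  frac-oriented-< : ∀ σ {a b c d} → 1 ≤ b → 1 ≤ d → Oriented σ _<_ (a * d) (c * b) →
                    Oriented σ ℚ._<_ (frac a b) (frac c d)
  frac-oriented-< true  1≤b 1≤d = frac-< 1≤b 1≤d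
  frac-oriented-< false 1≤b 1≤d = frac-< 1≤d 1≤b

  frac-sum-oriented-<⁻¹ : ∀ σ {a b c d e f g h} → 1 ≤ b → 1 ≤ d → 1 ≤ f → 1 ≤ h →
    Oriented σ ℚ._<_ (frac a b ℚ.+ frac c d) (frac e f ℚ.+ frac g h) →
    Oriented σ _<_ ((a * d + c * b) * (f * h)) ((e * h + g * f) * (b * d))
  frac-sum-oriented-<⁻¹ true  1≤b 1≤d 1≤f 1≤h lt =
    frac-<⁻¹ (*-positive 1≤b 1≤d) (*-positive 1≤f 1≤h) (subst₂ ℚ._<_ (frac-+ 1≤b 1≤d) (frac-+ 1≤f 1≤h) lt)
  frac-sum-oriented-<⁻¹ false 1≤b 1≤d 1≤f 1≤h lt =
    frac-<⁻¹ (*-positive 1≤f 1≤h) (*-positive 1≤b 1≤d) (subst₂ ℚ._<_ (frac-+ 1≤f 1≤h) (frac-+ 1≤b 1≤d) lt)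

  frac-sum-oriented-≤ : ∀ σ {a b c d e f g h} → 1 ≤ b → 1 ≤ d → 1 ≤ f → 1 ≤ h →
    Oriented σ _≤_ ((a * d + c * b) * (f * h)) ((e * h + g * f) * (b * d)) →
    Oriented σ ℚ._≤_ (frac a b ℚ.+ frac c d) (frac e f ℚ.+ frac g h)
  frac-sum-oriented-≤ true  1≤b 1≤d 1≤f 1≤h le =
    subst₂ ℚ._≤_ (sym (frac-+ 1≤b 1≤d)) (sym (frac-+ 1≤f 1≤h))
      (frac-≤ (*-positive 1≤b 1≤d) (*-positive 1≤f 1≤h) le)
  frac-sum-oriented-≤ false 1≤b 1≤d 1≤f 1≤h le =
    subst₂ ℚ._≤_ (sym (frac-+ 1≤f 1≤h)) (sym (frac-+ 1≤b 1≤d))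
      (frac-≤ (*-positive 1≤f 1≤h) (*-positive 1≤b 1≤d) le)

  value-step-< : ∀ σ S a → Det σ S → 1 ≤ St.q S → 1 ≤ a →
                 Oriented σ ℚ._<_ (value (step S a)) (value (step S (suc a)))
  value-step-< σ (st pp qp p q) a det 1≤q 1≤a =
    frac-oriented-< σ (step-positive qp 1≤a 1≤q) (step-positive {suc a} qp (s≤s z≤n) 1≤q)
      (balance-<⁻ σ (det-balance σ det det _ _ 0 1 (identity a p pp q qp)) (s≤s z≤n))
    where
    identity : ∀ a p pp q qp →
      (suc a * p + pp) * (a * q + qp) + 0 * (p * qp) + 1 * (pp * q) ≡
      (a * p + pp) * (suc a * q + qp) + 0 * (pp * q) + 1 * (p * qp)
    identity = solve-∀

  value-step-<-value : ∀ σ S a → Det σ S → 1 ≤ St.q S → 1 ≤ a → Oriented σ ℚ._<_ (value (step S a)) (value S)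
  value-step-<-value σ (st pp qp p q) a det 1≤q 1≤a =
    frac-oriented-< σ (step-positive qp 1≤a 1≤q) 1≤q
      (balance-<⁻ σ (det-balance σ det det _ _ 0 1 (identity a p pp q qp)) (s≤s z≤n))
    where
    identity : ∀ a p pp q qp →
      p * (a * q + qp) + 0 * (p * qp) + 1 * (pp * q) ≡ (a * p + pp) * q + 0 * (pp * q) + 1 * (p * qp)
    identity = solve-∀

  -- For S = conv B and S′ = conv C the hypothesis compares the gaps [C, u + 1] − [C, u] = ±1/(q_u q_{u+1})
  -- and [B] − [B, w + 1] = ±1/(t t_{w+1}).
  gap-< : ∀ σ S S′ u w → Det σ S → Det σ S′ → 1 ≤ St.q S → 1 ≤ St.q S′ → 1 ≤ u →
    Oriented σ ℚ._<_ (value (step S′ u) ℚ.+ value S) (value (step S (suc w)) ℚ.+ value (step S′ (suc u))) →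
    St.q (step S′ u) * St.q (step S′ (suc u)) < St.q S * St.q (step S (suc w))
  gap-< σ (st s′ t′ s t) (st p′ q′ p q) u w det det′ 1≤t 1≤q 1≤u h =
    balance-< σ (det-balance σ det det′ _ _ _ _ (identity s′ t′ s t p′ q′ p q u w))
      (frac-sum-oriented-<⁻¹ σ (step-positive q′ 1≤u 1≤q) 1≤t
        (step-positive {suc w} t′ (s≤s z≤n) 1≤t) (step-positive {suc u} q′ (s≤s z≤n) 1≤q) h)
    where
    identity : ∀ s′ t′ s t p′ q′ p q u w →
      ((suc w * s + s′) * (suc u * q + q′) + (suc u * p + p′) * (suc w * t + t′)) * ((u * q + q′) * t)
        + ((u * q + q′) * (suc u * q + q′)) * (s * t′) + (t * (suc w * t + t′)) * (p′ * q)
      ≡ ((u * p + p′) * t + s * (u * q + q′)) * ((suc w * t + t′) * (suc u * q + q′))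
        + ((u * q + q′) * (suc u * q + q′)) * (s′ * t) + (t * (suc w * t + t′)) * (p * q′)
    identity = solve-∀

  gap-<-one : ∀ σ S S′ u w → Det σ S → Det σ S′ → 1 ≤ St.q S → 1 ≤ St.q S′ →
    Oriented σ ℚ._<_ (value (step S 1) ℚ.+ value S′) (value (step S (suc w)) ℚ.+ value (step S′ (suc u))) →
    St.q (step S 1) * St.q (step S (suc w)) < w * St.q (step S′ (suc u)) * St.q S′
  gap-<-one σ (st s′ t′ s t) (st p′ q′ p q) u w det det′ 1≤t 1≤q h =
    balance-< σ (det-balance σ det′ det _ _ _ _ (identity s′ t′ s t p′ q′ p q u w))
      (frac-sum-oriented-<⁻¹ σ (step-positive {1} t′ (s≤s z≤n) 1≤t) 1≤q
        (step-positive {suc w} t′ (s≤s z≤n) 1≤t) (step-positive {suc u} q′ (s≤s z≤n) 1≤q) h)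
    where
    identity : ∀ s′ t′ s t p′ q′ p q u w →
      ((suc w * s + s′) * (suc u * q + q′) + (suc u * p + p′) * (suc w * t + t′)) * ((1 * t + t′) * q)
        + ((1 * t + t′) * (suc w * t + t′)) * (p * q′) + (w * (suc u * q + q′) * q) * (s′ * t)
      ≡ ((1 * s + s′) * q + p * (1 * t + t′)) * ((suc w * t + t′) * (suc u * q + q′))
        + ((1 * t + t′) * (suc w * t + t′)) * (p′ * q) + (w * (suc u * q + q′) * q) * (s * t′)
    identity = solve-∀

  gap-≤ : ∀ σ S S′ u w → Det σ S → Det σ S′ → 1 ≤ St.q S → 1 ≤ St.q S′ → 1 ≤ w →
    St.q (step S′ (suc u)) * St.q (step S′ (suc (suc u))) ≤ St.q (step S w) * St.q (step S (suc w)) →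
    Oriented σ ℚ._≤_ (value (step S (suc w)) ℚ.+ value (step S′ (suc u)))
                     (value (step S′ (suc (suc u))) ℚ.+ value (step S w))
  gap-≤ σ (st s′ t′ s t) (st p′ q′ p q) u w det det′ 1≤t 1≤q 1≤w h =
    frac-sum-oriented-≤ σ (step-positive {suc w} t′ (s≤s z≤n) 1≤t) (step-positive {suc u} q′ (s≤s z≤n) 1≤q)
      (step-positive {suc (suc u)} q′ (s≤s z≤n) 1≤q) (step-positive t′ 1≤w 1≤t)
      (balance-≤⁻ σ (det-balance σ det det′ _ _ _ _ (identity s′ t′ s t p′ q′ p q u w)) h)
    where
    identity : ∀ s′ t′ s t p′ q′ p q u w →
      ((suc (suc u) * p + p′) * (w * t + t′) + (w * s + s′) * (suc (suc u) * q + q′))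
          * ((suc w * t + t′) * (suc u * q + q′))
        + ((suc u * q + q′) * (suc (suc u) * q + q′)) * (s * t′) + ((w * t + t′) * (suc w * t + t′)) * (p′ * q)
      ≡ ((suc w * s + s′) * (suc u * q + q′) + (suc u * p + p′) * (suc w * t + t′))
          * ((suc (suc u) * q + q′) * (w * t + t′))
        + ((suc u * q + q′) * (suc (suc u) * q + q′)) * (s′ * t) + ((w * t + t′) * (suc w * t + t′)) * (p * q′)
    identity = solve-∀

  partial-quotient-< : ∀ {F Q T E H b q c} → 1 ≤ T → T ≤ H → c * q ≤ F →
                       F * Q < T * E → H * E < b * Q * q → c < b
  partial-quotient-< {F} {Q} {suc T} {E} {suc H} {b} {q} {c} _ T≤H cq≤F FQ<TE HE<bQq =
    ℕP.*-cancelʳ-< (q * suc T) c b (begin-strict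
      c * (q * suc T)  ≡⟨ ℕP.*-assoc c q (suc T) ⟨
      c * q * suc T    ≤⟨ ℕP.*-mono-≤ cq≤F T≤H ⟩
      F * suc H        <⟨ FH<Tbq ⟩
      suc T * b * q    ≡⟨ regroup (suc T) b q ⟩
      b * (q * suc T)  ∎)
    where
    open ℕP.≤-Reasoning
    regroup : ∀ T b q → T * b * q ≡ b * (q * T)
    regroup = solve-∀
    regroupˡ : ∀ Q F H → Q * (F * H) ≡ F * Q * H
    regroupˡ = solve-∀
    regroupʳ : ∀ T E H → T * E * H ≡ T * (H * E)
    regroupʳ = solve-∀
    regroupʳ′ : ∀ T b Q q → T * (b * Q * q) ≡ Q * (T * b * q)
    regroupʳ′ = solve-∀
    FH<Tbq : F * suc H < suc T * b * q
    FH<Tbq = ℕP.*-cancelˡ-< Q (F * suc H) (suc T * b * q) (begin-strict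
      Q * (F * suc H)          ≡⟨ regroupˡ Q F (suc H) ⟩
      F * Q * suc H            <⟨ ℕP.*-monoˡ-< (suc H) FQ<TE ⟩
      suc T * E * suc H        ≡⟨ regroupʳ (suc T) E (suc H) ⟩
      suc T * (suc H * E)      <⟨ ℕP.*-monoʳ-< (suc T) HE<bQq ⟩
      suc T * (b * Q * q)      ≡⟨ regroupʳ′ (suc T) b Q q ⟩
      Q * (suc T * b * q)      ∎)

  -- Cylinders around a real number

  Below : Bool → ℝ → ℚ → Set
  Below true  x r = U x r
  Below false x r = L x r

  +-cancelʳ-<ℚ : ∀ v {r r′} → r ℚ.+ v ℚ.< r′ ℚ.+ v → r ℚ.< r′
  +-cancelʳ-<ℚ v {r} h = ℚP.≰⇒> (λ r′≤r → ℚP.<-irrefl refl (ℚP.<-≤-trans h (ℚP.+-monoˡ-≤ v r′≤r)))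

  module _ (x : ℝ) where

    L-down-≤ : ∀ {a b} → b ℚ.≤ a → L x a → L x b
    L-down-≤ b≤a la with L-round x la
    ... | r , a<r , lr = L-down x (ℚP.≤-<-trans b≤a a<r) lr

    U-up-≤ : ∀ {a b} → a ℚ.≤ b → U x a → U x b
    U-up-≤ a≤b ua with U-round x ua
    ... | r , r<a , ur = U-up x (ℚP.<-≤-trans r<a a≤b) ur

    L<U : ∀ {a b} → L x a → U x b → a ℚ.< b
    L<U {a} {b} la ub = ℚP.≰⇒> (λ b≤a → disjoint x b (L-down-≤ b≤a la , ub))

    L<¬L : ∀ {a b} → L x a → ¬ L x b → a ℚ.< b
    L<¬L la ¬lb = ℚP.≰⇒> (λ b≤a → ¬lb (L-down-≤ b≤a la))

    ¬U<U : ∀ {a b} → ¬ U x a → U x b → a ℚ.< b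
    ¬U<U ¬ua ub = ℚP.≰⇒> (λ b≤a → ¬ua (U-up-≤ b≤a ub))

    ¬U⇒L : ∀ {a b} → b ℚ.< a → ¬ U x a → L x b
    ¬U⇒L b<a ¬ua = [ (λ lb → lb) , (λ ua → ⊥-elim (¬ua ua)) ]′ (located x b<a)

    ¬L⇒U : ∀ {a b} → a ℚ.< b → ¬ L x a → U x b
    ¬L⇒U a<b ¬la = [ (λ la → ⊥-elim (¬la la)) , (λ ub → ub) ]′ (located x a<b)

    baseCut : ℚ → Cut
    baseCut v = record
      { Lo      = λ p → L x (toℚ p ℚ.+ v)
      ; Up      = λ p → U x (toℚ p ℚ.+ v)
      ; Lo-down = λ {p} {q} q≤p → L-down-≤ (ℚP.+-monoˡ-≤ v (toℚ-≤ {q} {p} q≤p))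
      ; Up-up   = λ {p} {q} p≤q → U-up-≤ (ℚP.+-monoˡ-≤ v (toℚ-≤ {p} {q} p≤q))
      ; Lo<Up   = λ {p} {q} lo up → toℚ-<⁻¹ {p} {q} (+-cancelʳ-<ℚ v (L<U lo up))
      ; Lo⊎Up   = λ {p} {q} p<q → located x (ℚP.+-monoˡ-< v (toℚ-< {p} {q} p<q))
      }

    Below-not⇒¬Below : ∀ σ {r} → Below (not σ) x r → ¬ Below σ x r
    Below-not⇒¬Below true  l u = disjoint x _ (l , u)
    Below-not⇒¬Below false u l = disjoint x _ (l , u)

    ¬Below-Below⇒< : ∀ σ {r r′} → ¬ Below σ x r → Below σ x r′ → Oriented σ ℚ._<_ r r′
    ¬Below-Below⇒< true  ¬u u = ¬U<U ¬u u
    ¬Below-Below⇒< false ¬l l = L<¬L l ¬l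

    Below-mono : ∀ σ {r r′} → Below σ x r → Oriented σ ℚ._≤_ r r′ → Below σ x r′
    Below-mono true  u r≤r′ = U-up-≤ r≤r′ u
    Below-mono false l r′≤r = L-down-≤ r′≤r l

    InCyl⇒sides : ∀ σ {v as a} → Oriented σ ℚ._<_ (cfval (as ∷ʳ a) ℚ.+ v) (cfval (as ∷ʳ suc a) ℚ.+ v) →
      InCyl x v as a → ¬ Below σ x (cfval (as ∷ʳ a) ℚ.+ v) × Below σ x (cfval (as ∷ʳ suc a) ℚ.+ v)
    InCyl⇒sides true  o (inj₁ (inj₁ (l₁ , u₂)))  = (λ u₁ → disjoint x _ (l₁ , u₁)) , u₂
    InCyl⇒sides true  o (inj₁ (inj₂ (l₂ , u₁)))  = ⊥-elim (ℚP.<-asym o (L<U l₂ u₁))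
    InCyl⇒sides true  o (inj₂ ((¬l₁ , ¬u₁) , _)) = ¬u₁ , ¬L⇒U o ¬l₁
    InCyl⇒sides false o (inj₁ (inj₁ (l₁ , u₂)))  = ⊥-elim (ℚP.<-asym o (L<U l₁ u₂))
    InCyl⇒sides false o (inj₁ (inj₂ (l₂ , u₁)))  = (λ l₁ → disjoint x _ (l₁ , u₁)) , l₂
    InCyl⇒sides false o (inj₂ ((¬l₁ , ¬u₁) , _)) = ¬l₁ , ¬U⇒L o ¬u₁

    InCyl⇒InCylᶜ : ∀ {v a₀ as a} → All (1 ≤_) (a₀ ∷ as) → 1 ≤ a →
                   InCyl x v (a₀ ∷ as) a → InCylᶜ (baseCut v) (a₀ ∷ as) a
    InCyl⇒InCylᶜ {v} {a₀} {as} {a} pas 1≤a h =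
      Sum.map₂ (Prod.map₂ [ (λ 2≤a → 2≤a) , (λ ()) ∘ proj₁ ]′)
        (subst₂ Shape (cfval-fractionOf ((a₀ ∷ as) ∷ʳ a) (∷ʳ⁺ pas 1≤a))
                      (cfval-fractionOf ((a₀ ∷ as) ∷ʳ suc a) (∷ʳ⁺ pas (s≤s z≤n))) h)
      where
      Shape : ℚ → ℚ → Set
      Shape e₁ e₂ = ((L x (e₁ ℚ.+ v) × U x (e₂ ℚ.+ v)) ⊎ (L x (e₂ ℚ.+ v) × U x (e₁ ℚ.+ v)))
                  ⊎ ((¬ L x (e₁ ℚ.+ v) × ¬ U x (e₁ ℚ.+ v)) × (2 ≤ a ⊎ (a₀ ∷ as ≡ [] × a ≡ 1)))

    bounds⇒HalfOpenCyl : ∀ σ {v cs} → All (1 ≤_) cs →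
      ¬ Below σ x (cfval cs ℚ.+ v) → Below σ x (cfval (incLast cs) ℚ.+ v) → HalfOpenCyl (baseCut v) cs
    bounds⇒HalfOpenCyl true {v} {cs} pcs ¬u u =
      inj₁ (subst (λ e → ¬ U x (e ℚ.+ v)) (cfval-fractionOf cs pcs) ¬u ,
            subst (λ e → U x (e ℚ.+ v)) (cfval-fractionOf (incLast cs) (All-incLast pcs)) u)
    bounds⇒HalfOpenCyl false {v} {cs} pcs ¬l l =
      inj₂ (subst (λ e → L x (e ℚ.+ v)) (cfval-fractionOf (incLast cs) (All-incLast pcs)) l ,
            subst (λ e → ¬ L x (e ℚ.+ v)) (cfval-fractionOf cs pcs) ¬l)

    -- PQ only provides some prefix of length m + 1; the bounds identify it with cs.
    PQ⇒InCyl : ∀ σ {v m a} cs → length cs ≡ suc m → All (1 ≤_) cs →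
      ¬ Below σ x (cfval cs ℚ.+ v) → Below σ x (cfval (incLast cs) ℚ.+ v) →
      PQ x v (suc (suc m)) a → InCyl x v cs a
    PQ⇒InCyl σ {v} {m} {a} cs len pcs ¬b b (suc a₀ ∷ as , len′ , pas@(_ ∷ pas′) , 1≤a , h) =
      subst (λ ds → InCyl x v ds a)
        (cylinder-unique (baseCut v) (suc a₀ ∷ as) cs (trans len′ (sym len)) pas pcs
          (InCylᶜ⇒OpenCyl (baseCut v) a₀ as a pas′ 1≤a (InCyl⇒InCylᶜ pas 1≤a h))
          (bounds⇒HalfOpenCyl σ pcs ¬b b))
        h

    -- x − v lies between [as, a] (included) and [as, a + 1] (excluded), where S = conv as.
    Bounds : Bool → ℚ → St → ℕ → Set
    Bounds σ v S a = ¬ Below σ x (value (step S a) ℚ.+ v) × Below σ x (value (step S (suc a)) ℚ.+ v)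

    InCyl⇒Bounds : ∀ σ {v as a} → Det σ (conv as) → 1 ≤ denom as → 1 ≤ a →
                   InCyl x v as a → Bounds σ v (conv as) a
    InCyl⇒Bounds σ {v} {as} {a} det 1≤q 1≤a h =
      Prod.map (subst (λ e → ¬ Below σ x (e ℚ.+ v)) (cfval-∷ʳ as a))
               (subst (λ e → Below σ x (e ℚ.+ v)) (cfval-∷ʳ as (suc a)))
        (InCyl⇒sides σ (subst₂ (λ e e′ → Oriented σ ℚ._<_ (e ℚ.+ v) (e′ ℚ.+ v))
                                    (sym (cfval-∷ʳ as a)) (sym (cfval-∷ʳ as (suc a)))
                                    (oriented-+ˡ σ v (value-step-< σ (conv as) a det 1≤q 1≤a)))
                      h)

  -- The run of the algorithm

  module RunInvariant (x : ℝ) (x≤1 : ¬ L x ℚ.1ℚ) (k : ℕ) (c b : ℕ → ℕ) (run : Run x k c b) where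

    stateᶜ stateᵇ : ℕ → St
    stateᶜ m = conv (pre c m)
    stateᵇ m = conv (pre b m)

    stateᶜ-suc : ∀ m → stateᶜ (suc m) ≡ step (stateᶜ m) (c (suc m))
    stateᶜ-suc m = conv-∷ʳ (pre c m) (c (suc m))

    stateᵇ-suc : ∀ m → stateᵇ (suc m) ≡ step (stateᵇ m) (b (suc m))
    stateᵇ-suc m = conv-∷ʳ (pre b m) (b (suc m))

    b-positive : ∀ {i} → 1 ≤ i → i ≤ k → 1 ≤ b i
    b-positive {i} 1≤i i≤k with proj₁ (proj₂ run) i 1≤i i≤k
    ... | _ , _ , _ , 1≤bᵢ , _ = 1≤bᵢ

    c-≥2 : ∀ {i} → 1 ≤ i → i ≤ k → 2 ≤ c i
    c-≥2 {suc zero} _ _ with proj₁ run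
    ... | _ , (_ , _ , _ , 1≤a , _) , c≡ = subst (2 ≤_) (sym c≡) (s≤s 1≤a)
    c-≥2 {suc (suc i)} _ i≤k with proj₂ (proj₂ run) (suc i) (s≤s z≤n) i≤k
    ... | _ , (_ , _ , _ , 1≤a , _) , c≡ = subst (2 ≤_) (sym c≡) (s≤s 1≤a)

    All-b : ∀ {m} → m ≤ k → All (1 ≤_) (pre b m)
    All-b {m} m≤k = All-pre b m (λ 1≤i i≤m → b-positive 1≤i (ℕP.≤-trans i≤m m≤k))

    All-c : ∀ {m} → m ≤ k → All (1 ≤_) (pre c m)
    All-c {m} m≤k = All-pre c m (λ 1≤i i≤m → ℕP.≤-trans (s≤s z≤n) (c-≥2 1≤i (ℕP.≤-trans i≤m m≤k)))

    -- With n = m + 1: x − [c₁,…,cₙ] lies in the cylinder of [b₁,…,bₙ], x − [b₁,…,bₘ] in that of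
    -- [c₁,…,cₘ, cₙ − 1], x does not precede [b₁,…,bₘ, 1] + [c₁,…,cₘ] in the order of parity m
    -- (for m = 0 this is x ≤ 1), and the c-denominators are dominated by the b-denominators.
    record Invariant (m : ℕ) : Set where
      field
        u       : ℕ
        c≡1+u   : c (suc m) ≡ suc u
        boundsY : Bounds x (parity m) (value (stateᶜ (suc m))) (stateᵇ m) (b (suc m))
        boundsZ : Bounds x (parity m) (value (stateᵇ m)) (stateᶜ m) u
        lower   : ¬ Below (parity m) x (value (step (stateᵇ m) 1) ℚ.+ value (stateᶜ m))
        dom-qp  : St.qp (stateᶜ m) ≤ St.qp (stateᵇ m)
        dom-q   : St.q (stateᶜ m) ≤ St.q (stateᵇ m)

    invariant-zero : 1 ≤ k → Invariant 0
    invariant-zero 1≤k with proj₁ run | proj₁ (proj₂ run) 1 (s≤s z≤n) 1≤k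
    ... | u , ([] , _ , _ , 1≤u , inCylZ) , c≡ | [] , _ , _ , 1≤b₁ , inCylY = record
      { u       = u
      ; c≡1+u   = c≡
      ; boundsY = InCyl⇒Bounds x false refl (s≤s z≤n) 1≤b₁ inCylY
      ; boundsZ = InCyl⇒Bounds x false refl (s≤s z≤n) 1≤u inCylZ
      ; lower   = x≤1
      ; dom-qp  = ℕP.≤-refl
      ; dom-q   = ℕP.≤-refl
      }

    module Step {m} (m+1≤k : suc m ≤ k) (I : Invariant m) where
      open Invariant I

      private
        σ = parity m
        S = stateᵇ m
        S′ = stateᶜ m
        w = b (suc m)

        m≤k : m ≤ k
        m≤k = ℕP.≤-trans (ℕP.n≤1+n m) m+1≤k

        1≤t : 1 ≤ St.q S
        1≤t = denom-positive (pre b m) (All-b m≤k)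

        1≤q : 1 ≤ St.q S′
        1≤q = denom-positive (pre c m) (All-c m≤k)

        1≤u : 1 ≤ u
        1≤u = ≤-pred (subst (2 ≤_) c≡1+u (c-≥2 (s≤s z≤n) m+1≤k))

        1≤w : 1 ≤ w
        1≤w = b-positive (s≤s z≤n) m+1≤k

        stateᶜ-next : stateᶜ (suc m) ≡ step S′ (suc u)
        stateᶜ-next = trans (stateᶜ-suc m) (cong (step S′) c≡1+u)

        stateᵇ-next : stateᵇ (suc m) ≡ step S w
        stateᵇ-next = stateᵇ-suc m

        upperY : Below σ x (value (step S (suc w)) ℚ.+ value (step S′ (suc u)))
        upperY = subst (λ T → Below σ x (value (step S (suc w)) ℚ.+ value T)) stateᶜ-next (proj₂ boundsY)

      gap : St.q (step S′ u) * St.q (step S′ (suc u)) < St.q S * St.q (step S (suc w))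
      gap = gap-< σ S S′ u w (det-pre b m) (det-pre c m) 1≤t 1≤q 1≤u (¬Below-Below⇒< x σ (proj₁ boundsZ) upperY)

      u<w : u < w
      u<w = partial-quotient-< 1≤t t≤t₁ (m≤m+n (u * St.q S′) (St.qp S′)) gap
              (gap-<-one σ S S′ u w (det-pre b m) (det-pre c m) 1≤t 1≤q (¬Below-Below⇒< x σ lower upperY))
        where
        t≤t₁ : St.q S ≤ 1 * St.q S + St.qp S
        t≤t₁ = ℕP.≤-trans (ℕP.≤-reflexive (sym (*-identityˡ (St.q S)))) (m≤m+n (1 * St.q S) (St.qp S))

      denominators-< : qₙ c (suc m) * (qₙ c (suc m) ∸ qₙ c m) < qₙ b m * (qₙ b (suc m) + qₙ b m)
      denominators-< = subst₂ _<_ (trans (ℕP.*-comm F Q) (cong (_* F) (sym Q≡))) (cong (St.q S *_) (sym E≡))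
        (subst (λ G → G * Q < St.q S * E) (sym F≡) gap)
        where
        Q = St.q (step S′ (suc u))
        E = St.q (step S (suc w))
        F = qₙ c (suc m) ∸ qₙ c m
        Q≡ : qₙ c (suc m) ≡ Q
        Q≡ = cong St.q stateᶜ-next
        F≡ : F ≡ u * St.q S′ + St.qp S′
        F≡ = trans (cong (_∸ St.q S′) (trans Q≡ (ℕP.+-assoc (St.q S′) (u * St.q S′) (St.qp S′))))
                   (ℕP.m+n∸m≡n (St.q S′) (u * St.q S′ + St.qp S′))
        regroup : ∀ w t t′ → w * t + t′ + t ≡ suc w * t + t′
        regroup = solve-∀
        E≡ : qₙ b (suc m) + St.q S ≡ E
        E≡ = trans (cong (λ T → St.q T + St.q S) stateᵇ-next) (regroup w (St.q S) (St.qp S))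

      private
        q≤t : St.q (step S′ (suc u)) ≤ St.q (step S w)
        q≤t = ℕP.+-mono-≤ (ℕP.*-mono-≤ u<w dom-q) dom-qp

        gap-≤-premise : St.q (step S′ (suc u)) * St.q (step S′ (suc (suc u))) ≤
                        St.q (step S w) * St.q (step S (suc w))
        gap-≤-premise = ℕP.*-mono-≤ q≤t
          (subst₂ _≤_ (sym (ℕP.+-assoc (St.q S′) (suc u * St.q S′) (St.qp S′)))
                      (sym (ℕP.+-assoc (St.q S) (w * St.q S) (St.qp S)))
                      (ℕP.+-mono-≤ dom-q q≤t))

      nextZ : suc (suc m) ≤ k → Σ ℕ λ u′ → c (suc (suc m)) ≡ suc u′ ×
              Bounds x (not σ) (value (stateᵇ (suc m))) (stateᶜ (suc m)) u′
      nextZ m+2≤k with proj₂ (proj₂ run) (suc m) (s≤s z≤n) m+2≤k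
      ... | u′ , pq , c≡′ = u′ , c≡′ ,
        InCyl⇒Bounds x (not σ) (det-pre c (suc m)) (denom-positive (pre c (suc m)) (All-c m+1≤k)) 1≤u′
          (PQ⇒InCyl x σ (pre c (suc m)) (length-pre c (suc m)) (All-c m+1≤k) lowerZ′ upperZ′ pq)
        where
        1≤u′ : 1 ≤ u′
        1≤u′ = ≤-pred (subst (2 ≤_) c≡′ (c-≥2 (s≤s z≤n) m+2≤k))
        lowerZ′ : ¬ Below σ x (cfval (pre c (suc m)) ℚ.+ cfval (pre b (suc m)))
        lowerZ′ = subst (λ r → ¬ Below σ x r)
          (trans (cong (λ T → value T ℚ.+ value (stateᶜ (suc m))) (sym stateᵇ-next))
                 (ℚP.+-comm (value (stateᵇ (suc m))) (value (stateᶜ (suc m)))))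
          (proj₁ boundsY)
        upperZ′ : Below σ x (cfval (incLast (pre c (suc m))) ℚ.+ cfval (pre b (suc m)))
        upperZ′ = subst (Below σ x)
          (cong₂ ℚ._+_ (sym (trans (cfval-incLast-∷ʳ (pre c m) (c (suc m)))
                                   (cong (λ a → value (step S′ (suc a))) c≡1+u)))
                       (cong value (sym stateᵇ-next)))
          (Below-mono x σ upperY (gap-≤ σ S S′ u w (det-pre b m) (det-pre c m) 1≤t 1≤q 1≤w gap-≤-premise))

      nextY : suc (suc m) ≤ k → ∀ {u′} → c (suc (suc m)) ≡ suc u′ →
              Below (not σ) x (value (step (stateᶜ (suc m)) (suc u′)) ℚ.+ value (stateᵇ (suc m))) →
              Bounds x (not σ) (value (stateᶜ (suc (suc m)))) (stateᵇ (suc m)) (b (suc (suc m)))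
      nextY m+2≤k {u′} c≡′ upperZ′ =
        InCyl⇒Bounds x (not σ) (det-pre b (suc m)) (denom-positive (pre b (suc m)) (All-b m+1≤k))
          (b-positive (s≤s z≤n) m+2≤k)
          (PQ⇒InCyl x σ (pre b (suc m)) (length-pre b (suc m)) (All-b m+1≤k) lowerY′ upperY′
            (proj₁ (proj₂ run) (suc (suc m)) (s≤s z≤n) m+2≤k))
        where
        stateᶜ-next² : stateᶜ (suc (suc m)) ≡ step (stateᶜ (suc m)) (suc u′)
        stateᶜ-next² = trans (stateᶜ-suc (suc m)) (cong (step (stateᶜ (suc m))) c≡′)
        lowerY′ : ¬ Below σ x (cfval (pre b (suc m)) ℚ.+ cfval (pre c (suc (suc m))))
        lowerY′ = subst (λ r → ¬ Below σ x r)
          (trans (cong (λ T → value T ℚ.+ value (stateᵇ (suc m))) (sym stateᶜ-next²))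
                 (ℚP.+-comm (value (stateᶜ (suc (suc m)))) (value (stateᵇ (suc m)))))
          (Below-not⇒¬Below x σ upperZ′)
        c-increasing : Oriented σ ℚ._<_ (value (step S′ (suc u))) (value (stateᶜ (suc (suc m))))
        c-increasing = subst₂ (Oriented σ ℚ._<_) (cong value stateᶜ-next) (cong value (sym (stateᶜ-suc (suc m))))
          (oriented-not σ (value-step-<-value (not σ) (stateᶜ (suc m)) (c (suc (suc m))) (det-pre c (suc m))
            (denom-positive (pre c (suc m)) (All-c m+1≤k)) (ℕP.≤-trans (s≤s z≤n) (c-≥2 (s≤s z≤n) m+2≤k))))
        upperY′ : Below σ x (cfval (incLast (pre b (suc m))) ℚ.+ cfval (pre c (suc (suc m))))
        upperY′ = subst (λ r → Below σ x (r ℚ.+ cfval (pre c (suc (suc m)))))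
                        (sym (cfval-incLast-∷ʳ (pre b m) w))
          (Below-mono x σ upperY (oriented-+ʳ-≤ σ (value (step S (suc w))) c-increasing))

      lower′ : ¬ Below (not σ) x (value (step (stateᵇ (suc m)) 1) ℚ.+ value (stateᶜ (suc m)))
      lower′ = Below-not⇒¬Below x (not σ)
        (subst (λ τ → Below τ x (value (step (stateᵇ (suc m)) 1) ℚ.+ value (stateᶜ (suc m))))
               (sym (not-involutive σ))
        (subst (λ r → Below σ x (r ℚ.+ value (stateᶜ (suc m))))
          (trans (sym (value-step-one S w)) (cong (λ T → value (step T 1)) (sym stateᵇ-next))) (proj₂ boundsY)))

      next : suc (suc m) ≤ k → Invariant (suc m)
      next m+2≤k = assemble (nextZ m+2≤k)
        where
        assemble : (Σ ℕ λ u′ → c (suc (suc m)) ≡ suc u′ ×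
                              Bounds x (not σ) (value (stateᵇ (suc m))) (stateᶜ (suc m)) u′) →
                   Invariant (suc m)
        assemble (u′ , c≡′ , boundsZ′) = record
          { u       = u′
          ; c≡1+u   = c≡′
          ; boundsY = nextY m+2≤k c≡′ (proj₂ boundsZ′)
          ; boundsZ = boundsZ′
          ; lower   = lower′
          ; dom-qp  = subst₂ (λ T T′ → St.qp T ≤ St.qp T′) (sym stateᶜ-next) (sym stateᵇ-next) dom-q
          ; dom-q   = subst₂ (λ T T′ → St.q T ≤ St.q T′) (sym stateᶜ-next) (sym stateᵇ-next) q≤t
          }

    invariant : ∀ m → suc m ≤ k → Invariant m
    invariant zero    1≤k   = invariant-zero 1≤k
    invariant (suc m) m+2≤k = Step.next m+1≤k (invariant m m+1≤k) m+2≤k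
      where
      m+1≤k : suc m ≤ k
      m+1≤k = ℕP.≤-trans (ℕP.n≤1+n (suc m)) m+2≤k

    qₙ-c-increasing : ∀ m → suc m ≤ k → qₙ c m ≤ qₙ c (suc m)
    qₙ-c-increasing m m+1≤k = subst (qₙ c m ≤_) (cong St.q (sym (stateᶜ-suc m)))
      (step-q-≥ (stateᶜ m) (ℕP.≤-trans (s≤s z≤n) (c-≥2 (s≤s z≤n) m+1≤k)))

  ℕ<⇒ℤ< : ∀ {Q q t t₁} → q ≤ Q → Q * (Q ∸ q) < t * (t₁ + t) →
          ℤ.+ Q ℤ.* (ℤ.+ Q ℤ.- ℤ.+ q) ℤ.< ℤ.+ t ℤ.* (ℤ.+ t₁ ℤ.+ ℤ.+ t)
  ℕ<⇒ℤ< {Q} {q} {t} {t₁} q≤Q h = subst₂ ℤ._<_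
    (trans (ℤP.pos-* Q (Q ∸ q)) (cong (ℤ.+ Q ℤ.*_) (sym (trans (ℤP.[+m]-[+n]≡m⊖n Q q) (ℤP.⊖-≥ q≤Q)))))
    (trans (ℤP.pos-* t (t₁ + t)) (cong (ℤ.+ t ℤ.*_) (ℤP.pos-+ t₁ t)))
    (+<+ h)

open import Data.Nat using (ℕ; suc; _≤_; _∸_)
open import Data.Integer using (+_; _*_; _+_; _-_; _<_)
open import Data.Product using (_,_)
open Proof using (module RunInvariant; ℕ<⇒ℤ<)

lemma5 : (x : ℝ) → InUnit x → (k : ℕ) → 1 ≤ k → (c b : ℕ → ℕ) → Run x k c b →
         ∀ n → 1 ≤ n → n ≤ k →
         + qₙ c n * (+ qₙ c n - + qₙ c (n ∸ 1))
           < + qₙ b (n ∸ 1) * (+ qₙ b n + + qₙ b (n ∸ 1))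
lemma5 x (_ , x≤1) k _ c b run (suc m) _ m+1≤k =
  ℕ<⇒ℤ< {qₙ c (suc m)} {qₙ c m} {qₙ b m} {qₙ b (suc m)} (qₙ-c-increasing m m+1≤k)
    (Step.denominators-< m+1≤k (invariant m m+1≤k))
  where open RunInvariant x x≤1 k c b run
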